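{- Let $n\ge 1$ be an integer. The repunit $R(2^n)$ is the product of $n$ pairwise distinct positive integers. Moreover, $R(2^n)$ can be expressed as a product $A\times B$ for at least $M$ pairwise distinct (unordered) polynomial pairs $(A,B)$, where $$M=\begin{cases}\sum_{j=1}^{k}\binom{n}{j}, & \text{if } n=2k+1,\\ \sum_{j=1}^{k-1}\binom{n}{j}+\frac12\binom{n}{k}, & \text{if } n=2k.\end{cases}$$
   Context: For a positive integer $m$, the repunit $R(m)=\sum_{i=0}^{m-1}10^i=\frac{10^m-1}{9}$ is the $m$-digit number all of whose decimal digits are $1$. For a positive integer $A=\sum_{i=0}^a a_i10^i$ in decimal (digits $a_i\in\{0,\dots,9\}$, $a_a\ne0$), let $P(A,x)=\sum_{i=0}^a a_ix^i$. A pair $(A,B)$ of positive integers is a polynomial pair if $P(A,x)P(B,x)=P(A\times B,x)$. -}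

module Defs where

open import Data.Nat using (ℕ; zero; suc; _+_; _*_; _∸_; _^_; _≤_; _<_)
open import Data.Nat.DivMod using (_/_; _%_)
open import Data.Nat.Combinatorics using (_C_)
open import Data.Nat.ListAction using (product)
open import Data.List using (List; length)
open import Data.List.Relation.Unary.All using (All)
open import Data.List.Relation.Unary.Unique.Propositional using (Unique)
open import Data.Product using (_×_; Σ; ∃; _,_)
open import Relation.Binary.PropositionalEquality using (_≡_)

R : ℕ → ℕ
R zero    = 0
R (suc m) = R m + 10 ^ m

-- i-th decimal digit of A (little-endian); it is the coefficient of x^i
-- in P(A,x), i.e. floor(A / 10^i) mod 10 (and 0 for i beyond the leading digit).
digit : ℕ → ℕ → ℕ
digit zero    A = A % 10
digit (suc i) A = digit i (A / 10)

sumUpTo : ℕ → (ℕ → ℕ) → ℕ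
sumUpTo zero    f = f 0
sumUpTo (suc i) f = sumUpTo i f + f (suc i)

sum1To : ℕ → (ℕ → ℕ) → ℕ
sum1To zero    f = 0
sum1To (suc k) f = sum1To k f + f (suc k)

-- coefficient of x^i in P(A,x) * P(B,x)
prodCoeff : ℕ → ℕ → ℕ → ℕ
prodCoeff A B i = sumUpTo i (λ j → digit j A * digit (i ∸ j) B)

-- (A,B) is a polynomial pair: A, B positive and P(A,x)P(B,x) = P(A*B,x)
-- as polynomials, i.e. coefficientwise.
PolyPair : ℕ → ℕ → Set
PolyPair A B = (0 < A) × (0 < B) × (∀ i → prodCoeff A B i ≡ digit i (A * B))

M : ℕ → ℕ
M n with n % 2
... | zero  = sum1To (n / 2 ∸ 1) (λ j → n C j) + (n C (n / 2)) / 2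
... | suc _ = sum1To (n / 2) (λ j → n C j)

module Submission where

-- As polynomials,
--   1 + x + ... + x^(2^n - 1)  =  (1 + x)(1 + x^2)(1 + x^4) ... (1 + x^(2^(n-1))),
-- and evaluating at x = 10 gives R(2^n) as a product of the n distinct numbers
-- 1 + 10^(2^i).  Distributing the n factors over two sides A and B yields
-- 0/1-digit polynomials P(A,x), P(B,x) whose product has only 0/1 coefficients,
-- so no carries occur and (A,B) is a polynomial pair.

open import Defs
open import Data.Nat using (ℕ; _*_; _^_; _≤_; _<_)
open import Data.Nat.ListAction using (product)
open import Data.List using (List; length)
open import Data.List.Relation.Unary.All using (All)
open import Data.List.Relation.Unary.Unique.Propositional using (Unique)
open import Data.Product using (_×_; Σ; ∃; _,_; proj₁; proj₂)
open import Relation.Binary.PropositionalEquality using (_≡_)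

open import Data.Nat using (zero; suc; _+_; _∸_; z≤n; s≤s)
open import Data.Nat.Properties
open import Data.Nat.DivMod using (_/_; _%_; [m+kn]%n≡m%n; m*n%n≡0; m*n/n≡m; m/n*n≤m; m<n⇒m/n≡0; m<n⇒m%n≡m; +-distrib-/-∣ʳ)
open import Data.Nat.Divisibility using (n∣m*n)
open import Data.Nat.Combinatorics using (_C_; nCk+nC[k+1]≡[n+1]C[k+1]; k>n⇒nCk≡0; nCk≡nC[n∸k])
open import Data.Nat.Tactic.RingSolver using (solve-∀)
open import Data.List using ([]; _∷_; _++_; replicate; map)
open import Data.List.Properties using (length-++; length-map; length-replicate)
import Data.List.Relation.Unary.All as All
import Data.List.Relation.Unary.All.Properties as All
open import Data.List.Relation.Unary.All using ([]; _∷_)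
import Data.List.Relation.Unary.AllPairs as AllPairs
open import Data.List.Relation.Unary.AllPairs using (AllPairs; []; _∷_)
import Data.List.Relation.Unary.AllPairs.Properties as AllPairs
open import Function using (_∘_)
open import Relation.Binary.PropositionalEquality using (refl; sym; trans; cong; cong₂; _≢_; module ≡-Reasoning)

sumUpTo-cong : ∀ i {f g : ℕ → ℕ} → (∀ j → j ≤ i → f j ≡ g j) → sumUpTo i f ≡ sumUpTo i g
sumUpTo-cong zero    f≗g = f≗g 0 z≤n
sumUpTo-cong (suc i) f≗g =
  cong₂ _+_ (sumUpTo-cong i (λ j j≤i → f≗g j (m≤n⇒m≤1+n j≤i))) (f≗g (suc i) ≤-refl)

sumUpTo-+ : ∀ i f g → sumUpTo i (λ j → f j + g j) ≡ sumUpTo i f + sumUpTo i g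
sumUpTo-+ zero    f g = refl
sumUpTo-+ (suc i) f g rewrite sumUpTo-+ i f g =
  interchange (sumUpTo i f) (sumUpTo i g) (f (suc i)) (g (suc i))
  where
  interchange : ∀ a b c d → a + b + (c + d) ≡ a + c + (b + d)
  interchange = solve-∀

sumUpTo-0 : ∀ i → sumUpTo i (λ _ → 0) ≡ 0
sumUpTo-0 zero    = refl
sumUpTo-0 (suc i) = cong (_+ 0) (sumUpTo-0 i)

sumUpTo-peel : ∀ i f → sumUpTo (suc i) f ≡ f 0 + sumUpTo i (λ j → f (suc j))
sumUpTo-peel zero    f = refl
sumUpTo-peel (suc i) f rewrite sumUpTo-peel i f = +-assoc (f 0) _ _

sumUpTo-reverse : ∀ i h → sumUpTo i h ≡ sumUpTo i (λ j → h (i ∸ j))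
sumUpTo-reverse zero    h = refl
sumUpTo-reverse (suc i) h = begin
  sumUpTo i h + h (suc i)                    ≡⟨ +-comm _ (h (suc i)) ⟩
  h (suc i) + sumUpTo i h                    ≡⟨ cong (h (suc i) +_) (sumUpTo-reverse i h) ⟩
  h (suc i) + sumUpTo i (λ j → h (i ∸ j))    ≡⟨ sym (sumUpTo-peel i (λ j → h (suc i ∸ j))) ⟩
  sumUpTo (suc i) (λ j → h (suc i ∸ j))      ∎
  where open ≡-Reasoning

sumUpTo-split : ∀ a b f → sumUpTo (a + suc b) f ≡ sumUpTo a f + sumUpTo b (λ j → f (suc a + j))
sumUpTo-split a zero    f rewrite +-suc a 0 | +-identityʳ a = refl
sumUpTo-split a (suc b) f rewrite +-suc a (suc b) | sumUpTo-split a b f | +-suc a b =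
  +-assoc (sumUpTo a f) _ _

sumUpTo≡head+sum1To : ∀ i f → sumUpTo i f ≡ f 0 + sum1To i f
sumUpTo≡head+sum1To zero    f = sym (+-identityʳ _)
sumUpTo≡head+sum1To (suc i) f rewrite sumUpTo≡head+sum1To i f = +-assoc (f 0) _ _

conv : (ℕ → ℕ) → (ℕ → ℕ) → ℕ → ℕ
conv f g i = sumUpTo i (λ j → f j * g (i ∸ j))

conv-cong : ∀ {f f′ g g′} → (∀ j → f j ≡ f′ j) → (∀ j → g j ≡ g′ j) →
            ∀ i → conv f g i ≡ conv f′ g′ i
conv-cong f≗f′ g≗g′ i = sumUpTo-cong i (λ j _ → cong₂ _*_ (f≗f′ j) (g≗g′ (i ∸ j)))

conv-comm : ∀ f g i → conv f g i ≡ conv g f i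
conv-comm f g i = trans (sumUpTo-reverse i _) (sumUpTo-cong i λ j j≤i →
  trans (cong (λ k → f (i ∸ j) * g k) (m∸[m∸n]≡n j≤i)) (*-comm (f (i ∸ j)) (g j)))

conv-distribʳ : ∀ f g h i → conv f (λ j → g j + h j) i ≡ conv f g i + conv f h i
conv-distribʳ f g h i =
  trans (sumUpTo-cong i (λ j _ → *-distribˡ-+ (f j) (g (i ∸ j)) (h (i ∸ j)))) (sumUpTo-+ i _ _)

conv-unitˡ : ∀ {e} → e 0 ≡ 1 → (∀ j → e (suc j) ≡ 0) → ∀ g i → conv e g i ≡ g i
conv-unitˡ {e} e0≡1 _ g zero = trans (cong (_* g 0) e0≡1) (*-identityˡ (g 0))
conv-unitˡ {e} e0≡1 e+≡0 g (suc i) = begin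
  conv e g (suc i)                                          ≡⟨ sumUpTo-peel i _ ⟩
  e 0 * g (suc i) + sumUpTo i (λ j → e (suc j) * g (i ∸ j))  ≡⟨ cong₂ _+_ (cong (_* g (suc i)) e0≡1)
                                                                  (sumUpTo-cong i (λ j _ → cong (_* g (i ∸ j)) (e+≡0 j))) ⟩
  1 * g (suc i) + sumUpTo i (λ _ → 0)                       ≡⟨ cong₂ _+_ (*-identityˡ (g (suc i))) (sumUpTo-0 i) ⟩
  g (suc i) + 0                                             ≡⟨ +-identityʳ _ ⟩
  g (suc i)                                                 ∎
  where open ≡-Reasoning

shift : (ℕ → ℕ) → ℕ → ℕ
shift g zero    = 0
shift g (suc i) = g i

shiftBy : ℕ → (ℕ → ℕ) → ℕ → ℕ
shiftBy zero    g = g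
shiftBy (suc N) g = shift (shiftBy N g)

shiftBy-cong : ∀ N {g h} → (∀ j → g j ≡ h j) → ∀ i → shiftBy N g i ≡ shiftBy N h i
shiftBy-cong zero    g≗h i       = g≗h i
shiftBy-cong (suc N) g≗h zero    = refl
shiftBy-cong (suc N) g≗h (suc i) = shiftBy-cong N g≗h i

conv-shift : ∀ f g i → conv f (shift g) i ≡ shift (conv f g) i
conv-shift f g zero    = *-zeroʳ (f 0)
conv-shift f g (suc i) = trans
  (cong₂ _+_ (sumUpTo-cong i (λ j j≤i → cong (λ k → f j * shift g k) (+-∸-assoc 1 j≤i)))
             (trans (cong (λ k → f (suc i) * shift g k) (n∸n≡0 i)) (*-zeroʳ (f (suc i)))))
  (+-identityʳ (conv f g i))

conv-shiftBy : ∀ N f g i → conv f (shiftBy N g) i ≡ shiftBy N (conv f g) i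
conv-shiftBy zero    f g i       = refl
conv-shiftBy (suc N) f g zero    = conv-shift f (shiftBy N g) zero
conv-shiftBy (suc N) f g (suc i) = trans (conv-shift f (shiftBy N g) (suc i)) (conv-shiftBy N f g i)

Digits : List ℕ → Set
Digits = All (_< 10)

fromDigits : List ℕ → ℕ
fromDigits []       = 0
fromDigits (d ∷ ds) = d + fromDigits ds * 10

digitAt : List ℕ → ℕ → ℕ
digitAt []       i       = 0
digitAt (d ∷ ds) zero    = d
digitAt (d ∷ ds) (suc i) = digitAt ds i

digit-0 : ∀ i → digit i 0 ≡ 0
digit-0 zero    = refl
digit-0 (suc i) = digit-0 i

digit-fromDigits : ∀ {ds} → Digits ds → ∀ i → digit i (fromDigits ds) ≡ digitAt ds i
digit-fromDigits []                 i       = digit-0 i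
digit-fromDigits (_∷_ {d} {ds} d<10 _) zero = trans ([m+kn]%n≡m%n d (fromDigits ds) 10) (m<n⇒m%n≡m d<10)
digit-fromDigits (_∷_ {d} {ds} d<10 ds<10) (suc i) =
  trans (cong (digit i) drop-last) (digit-fromDigits ds<10 i)
  where
  drop-last : (d + fromDigits ds * 10) / 10 ≡ fromDigits ds
  drop-last = trans (+-distrib-/-∣ʳ d (n∣m*n (fromDigits ds)))
                    (cong₂ _+_ (m<n⇒m/n≡0 d<10) (m*n/n≡m (fromDigits ds) 10))

fromDigits-++ : ∀ xs ys → fromDigits (xs ++ ys) ≡ fromDigits xs + 10 ^ length xs * fromDigits ys
fromDigits-++ []       ys = sym (+-identityʳ (fromDigits ys))
fromDigits-++ (x ∷ xs) ys rewrite fromDigits-++ xs ys = regroup x (fromDigits xs) (10 ^ length xs) (fromDigits ys)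
  where
  regroup : ∀ x a p b → x + (a + p * b) * 10 ≡ x + a * 10 + 10 * p * b
  regroup = solve-∀

fromDigits-< : ∀ {ds} → Digits ds → fromDigits ds < 10 ^ length ds
fromDigits-< []                           = s≤s z≤n
fromDigits-< (_∷_ {d} {ds} d<10 ds<10) = begin-strict
  d + fromDigits ds * 10     <⟨ +-monoˡ-< (fromDigits ds * 10) d<10 ⟩
  10 + fromDigits ds * 10    ≤⟨ *-monoˡ-≤ 10 (fromDigits-< ds<10) ⟩
  10 ^ length ds * 10        ≡⟨ *-comm (10 ^ length ds) 10 ⟩
  10 ^ suc (length ds)       ∎
  where open ≤-Reasoning

fromDigits-pos : ∀ ds → digitAt ds 0 ≡ 1 → 0 < fromDigits ds
fromDigits-pos (d ∷ ds) refl = s≤s z≤n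

digitAt-++ : ∀ xs ys i → digitAt (xs ++ ys) i ≡ digitAt xs i + shiftBy (length xs) (digitAt ys) i
digitAt-++ []       ys i       = refl
digitAt-++ (x ∷ xs) ys zero    = sym (+-identityʳ x)
digitAt-++ (x ∷ xs) ys (suc i) = digitAt-++ xs ys i

digitAt-head : ∀ xs ys → digitAt xs 0 ≡ 1 → digitAt (xs ++ ys) 0 ≡ 1
digitAt-head (x ∷ xs) ys x≡1 = x≡1

digitAt-zeros : ∀ k i → digitAt (replicate k 0) i ≡ 0
digitAt-zeros zero    i       = refl
digitAt-zeros (suc k) zero    = refl
digitAt-zeros (suc k) (suc i) = digitAt-zeros k i

digitAt-pad : ∀ xs k i → digitAt (xs ++ replicate k 0) i ≡ digitAt xs i
digitAt-pad []       k i       = digitAt-zeros k i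
digitAt-pad (x ∷ xs) k zero    = refl
digitAt-pad (x ∷ xs) k (suc i) = digitAt-pad xs k i

fromDigits-zeros : ∀ k → fromDigits (replicate k 0) ≡ 0
fromDigits-zeros zero    = refl
fromDigits-zeros (suc k) = cong (_* 10) (fromDigits-zeros k)

fromDigits-pad : ∀ xs k → fromDigits (xs ++ replicate k 0) ≡ fromDigits xs
fromDigits-pad []       k = fromDigits-zeros k
fromDigits-pad (x ∷ xs) k = cong (λ v → x + v * 10) (fromDigits-pad xs k)

fromDigits-double : ∀ xs → fromDigits (xs ++ xs) ≡ (1 + 10 ^ length xs) * fromDigits xs
fromDigits-double xs = trans (fromDigits-++ xs xs) (distrib (fromDigits xs) (10 ^ length xs))
  where
  distrib : ∀ a p → a + p * a ≡ (1 + p) * a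
  distrib = solve-∀

fromDigits-double-large : ∀ xs → digitAt xs 0 ≡ 1 → 10 ^ length xs ≤ fromDigits (xs ++ xs)
fromDigits-double-large xs unit = begin
  10 ^ length xs                          ≡⟨ sym (*-identityʳ _) ⟩
  10 ^ length xs * 1                      ≤⟨ *-monoʳ-≤ (10 ^ length xs) (fromDigits-pos xs unit) ⟩
  10 ^ length xs * fromDigits xs          ≤⟨ m≤n+m _ (fromDigits xs) ⟩
  fromDigits xs + 10 ^ length xs * fromDigits xs  ≡⟨ sym (fromDigits-++ xs xs) ⟩
  fromDigits (xs ++ xs)                   ∎
  where open ≤-Reasoning

twice : ∀ N → 2 * N ≡ N + N
twice N = cong (N +_) (+-identityʳ N)

ones : ℕ → List ℕ
ones N = replicate N 1

replicate-+ : ∀ m n (x : ℕ) → replicate (m + n) x ≡ replicate m x ++ replicate n x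
replicate-+ zero    n x = refl
replicate-+ (suc m) n x = cong (x ∷_) (replicate-+ m n x)

ones-double : ∀ N → ones (2 * N) ≡ ones N ++ ones N
ones-double N = trans (cong ones (twice N)) (replicate-+ N N 1)

R-ones : ∀ m → R m ≡ fromDigits (ones m)
R-ones zero    = refl
R-ones (suc m) = begin
  R m + 10 ^ m                                      ≡⟨ cong₂ _+_ (R-ones m) (sym (*-identityʳ (10 ^ m))) ⟩
  fromDigits (ones m) + 10 ^ m * 1                  ≡⟨ cong (λ k → fromDigits (ones m) + 10 ^ k * 1) (sym (length-replicate m)) ⟩
  fromDigits (ones m) + 10 ^ length (ones m) * 1    ≡⟨ sym (fromDigits-++ (ones m) (ones 1)) ⟩
  fromDigits (ones m ++ ones 1)                     ≡⟨ cong fromDigits (sym (replicate-+ m 1 1)) ⟩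
  fromDigits (ones (m + 1))                         ≡⟨ cong (fromDigits ∘ ones) (+-comm m 1) ⟩
  fromDigits (ones (suc m))                         ∎
  where open ≡-Reasoning

R-double : ∀ N → R (2 * N) ≡ (1 + 10 ^ N) * R N
R-double N = begin
  R (2 * N)                                     ≡⟨ R-ones (2 * N) ⟩
  fromDigits (ones (2 * N))                     ≡⟨ cong fromDigits (ones-double N) ⟩
  fromDigits (ones N ++ ones N)                 ≡⟨ fromDigits-double (ones N) ⟩
  (1 + 10 ^ length (ones N)) * fromDigits (ones N)  ≡⟨ cong₂ (λ k v → (1 + 10 ^ k) * v) (length-replicate N) (sym (R-ones N)) ⟩
  (1 + 10 ^ N) * R N                            ∎
  where open ≡-Reasoning

digitAt-ones-double : ∀ N i →
  digitAt (ones N) i + shiftBy N (digitAt (ones N)) i ≡ digitAt (ones (2 * N)) i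
digitAt-ones-double N i = begin
  digitAt (ones N) i + shiftBy N (digitAt (ones N)) i
    ≡⟨ cong (λ k → digitAt (ones N) i + shiftBy k (digitAt (ones N)) i) (sym (length-replicate N)) ⟩
  digitAt (ones N) i + shiftBy (length (ones N)) (digitAt (ones N)) i
    ≡⟨ sym (digitAt-++ (ones N) (ones N) i) ⟩
  digitAt (ones N ++ ones N) i
    ≡⟨ cong (λ ds → digitAt ds i) (sym (ones-double N)) ⟩
  digitAt (ones (2 * N)) i
    ∎
  where open ≡-Reasoning

record Split (N : ℕ) : Set where
  field
    left right   : List ℕ
    left-length  : length left ≡ N
    right-length : length right ≡ N
    left-digits  : Digits left
    right-digits : Digits right
    left-unit    : digitAt left 0 ≡ 1
    right-unit   : digitAt right 0 ≡ 1
    coeffs       : ∀ i → conv (digitAt left) (digitAt right) i ≡ digitAt (ones N) i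
    value        : fromDigits left * fromDigits right ≡ R N

open Split

leftValue : ∀ {N} → Split N → ℕ
leftValue s = fromDigits (left s)

toPair : ∀ {N} → Split N → ℕ × ℕ
toPair s = fromDigits (left s) , fromDigits (right s)

-- A split is a polynomial pair: the digits of the factors are the coefficients,
-- and the product polynomial has 0/1 coefficients, the digits of R(N).
split-polyPair : ∀ {N} (s : Split N) → PolyPair (fromDigits (left s)) (fromDigits (right s))
split-polyPair {N} s =
  fromDigits-pos (left s) (left-unit s) , fromDigits-pos (right s) (right-unit s) , λ i → begin
    prodCoeff A B i                     ≡⟨ conv-cong (digit-fromDigits (left-digits s)) (digit-fromDigits (right-digits s)) i ⟩
    conv (digitAt (left s)) (digitAt (right s)) i  ≡⟨ coeffs s i ⟩
    digitAt (ones N) i                  ≡⟨ sym (digit-fromDigits (All.replicate⁺ N (s≤s (s≤s z≤n))) i) ⟩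
    digit i (fromDigits (ones N))       ≡⟨ cong (digit i) (trans (sym (R-ones N)) (sym (value s))) ⟩
    digit i (A * B)                     ∎
  where
  open ≡-Reasoning
  A = fromDigits (left s)
  B = fromDigits (right s)

leftValue-< : ∀ {N} (s : Split N) → leftValue s < 10 ^ N
leftValue-< s rewrite sym (left-length s) = fromDigits-< (left-digits s)

unitSplit : Split 1
unitSplit = record
  { left = 1 ∷ [] ; right = 1 ∷ [] ; left-length = refl ; right-length = refl
  ; left-digits = s≤s (s≤s z≤n) ∷ [] ; right-digits = s≤s (s≤s z≤n) ∷ []
  ; left-unit = refl ; right-unit = refl
  ; coeffs = conv-unitˡ {digitAt (1 ∷ [])} refl (λ _ → refl) (digitAt (1 ∷ [])) ; value = refl }

swap : ∀ {N} → Split N → Split N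
swap s = record
  { left = right s ; right = left s ; left-length = right-length s ; right-length = left-length s
  ; left-digits = right-digits s ; right-digits = left-digits s
  ; left-unit = right-unit s ; right-unit = left-unit s
  ; coeffs = λ i → trans (conv-comm (digitAt (right s)) (digitAt (left s)) i) (coeffs s i)
  ; value = trans (*-comm (fromDigits (right s)) (fromDigits (left s))) (value s) }

extendʳ-coeffs : ∀ {N l r} → length r ≡ N →
  (∀ i → conv (digitAt l) (digitAt r) i ≡ digitAt (ones N) i) →
  ∀ i → conv (digitAt (l ++ replicate N 0)) (digitAt (r ++ r)) i ≡ digitAt (ones (2 * N)) i
extendʳ-coeffs {N} {l} {r} refl lr≡ones i = begin
  conv (digitAt (l ++ replicate N 0)) (digitAt (r ++ r)) i
    ≡⟨ conv-cong (digitAt-pad l N) (digitAt-++ r r) i ⟩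
  conv (digitAt l) (λ j → digitAt r j + shiftBy N (digitAt r) j) i
    ≡⟨ conv-distribʳ (digitAt l) (digitAt r) (shiftBy N (digitAt r)) i ⟩
  conv (digitAt l) (digitAt r) i + conv (digitAt l) (shiftBy N (digitAt r)) i
    ≡⟨ cong (conv (digitAt l) (digitAt r) i +_) (conv-shiftBy N (digitAt l) (digitAt r) i) ⟩
  conv (digitAt l) (digitAt r) i + shiftBy N (conv (digitAt l) (digitAt r)) i
    ≡⟨ cong₂ _+_ (lr≡ones i) (shiftBy-cong N lr≡ones i) ⟩
  digitAt (ones N) i + shiftBy N (digitAt (ones N)) i
    ≡⟨ digitAt-ones-double N i ⟩
  digitAt (ones (2 * N)) i
    ∎
  where open ≡-Reasoning

extendʳ-value : ∀ {N l r} → length r ≡ N → fromDigits l * fromDigits r ≡ R N →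
  fromDigits (l ++ replicate N 0) * fromDigits (r ++ r) ≡ R (2 * N)
extendʳ-value {N} {l} {r} refl lr≡R = begin
  fromDigits (l ++ replicate N 0) * fromDigits (r ++ r)
    ≡⟨ cong₂ _*_ (fromDigits-pad l N) (fromDigits-double r) ⟩
  fromDigits l * ((1 + 10 ^ N) * fromDigits r)
    ≡⟨ x∙yz≡y∙xz (fromDigits l) (1 + 10 ^ N) (fromDigits r) ⟩
  (1 + 10 ^ N) * (fromDigits l * fromDigits r)
    ≡⟨ cong ((1 + 10 ^ N) *_) lr≡R ⟩
  (1 + 10 ^ N) * R N
    ≡⟨ sym (R-double N) ⟩
  R (2 * N)
    ∎
  where
  open ≡-Reasoning
  x∙yz≡y∙xz : ∀ x y z → x * (y * z) ≡ y * (x * z)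
  x∙yz≡y∙xz = solve-∀

extendʳ : ∀ {N} → Split N → Split (2 * N)
extendʳ {N} s = record
  { left = left s ++ replicate N 0 ; right = right s ++ right s
  ; left-length = trans (length-++ (left s)) (trans (cong₂ _+_ (left-length s) (length-replicate N)) (sym (twice N)))
  ; right-length = trans (length-++ (right s)) (trans (cong₂ _+_ (right-length s) (right-length s)) (sym (twice N)))
  ; left-digits = All.++⁺ (left-digits s) (All.replicate⁺ N (s≤s z≤n))
  ; right-digits = All.++⁺ (right-digits s) (right-digits s)
  ; left-unit = digitAt-head (left s) _ (left-unit s)
  ; right-unit = digitAt-head (right s) _ (right-unit s)
  ; coeffs = extendʳ-coeffs {l = left s} {r = right s} (right-length s) (coeffs s)
  ; value = extendʳ-value {l = left s} {r = right s} (right-length s) (value s) }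

extendˡ : ∀ {N} → Split N → Split (2 * N)
extendˡ s = swap (extendʳ (swap s))

leftValue-extendʳ : ∀ {N} (s : Split N) → leftValue (extendʳ s) ≡ leftValue s
leftValue-extendʳ {N} s = fromDigits-pad (left s) N

leftValue-extendˡ : ∀ {N} (s : Split N) → leftValue (extendˡ s) ≡ (1 + 10 ^ N) * leftValue s
leftValue-extendˡ s rewrite sym (left-length s) = fromDigits-double (left s)

leftValue-extendˡ-large : ∀ {N} (s : Split N) → 10 ^ N ≤ leftValue (extendˡ s)
leftValue-extendˡ-large s rewrite sym (left-length s) = fromDigits-double-large (left s) (left-unit s)

-- The 2^n splits of 1 + x + ... + x^(2^n - 1), one per choice of side for each
-- factor 1 + x^(2^i).
splits : (n : ℕ) → List (Split (2 ^ n))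
splits zero    = unitSplit ∷ []
splits (suc n) = map extendʳ (splits n) ++ map extendˡ (splits n)

splits-length : ∀ n → length (splits n) ≡ 2 ^ n
splits-length zero    = refl
splits-length (suc n) = begin
  length (map extendʳ (splits n) ++ map extendˡ (splits n))
    ≡⟨ length-++ (map extendʳ (splits n)) ⟩
  length (map extendʳ (splits n)) + length (map extendˡ (splits n))
    ≡⟨ cong₂ _+_ (length-map extendʳ (splits n)) (length-map extendˡ (splits n)) ⟩
  length (splits n) + length (splits n)
    ≡⟨ cong₂ _+_ (splits-length n) (splits-length n) ⟩
  2 ^ n + 2 ^ n
    ≡⟨ sym (twice (2 ^ n)) ⟩
  2 ^ suc n
    ∎
  where open ≡-Reasoning

LeftsDiffer : ∀ {N} → Split N → Split N → Set
LeftsDiffer s t = leftValue s ≢ leftValue t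

-- The splits of one level have pairwise distinct left values: each doubling
-- step is injective on left values, and the two steps land on either side of 10^N.
splits-distinct : ∀ n → AllPairs LeftsDiffer (splits n)
splits-distinct zero    = [] ∷ []
splits-distinct (suc n) = AllPairs.++⁺
  (AllPairs.map⁺ (AllPairs.map (λ {s} {t} → extendʳ-injective {s} {t}) (splits-distinct n)))
  (AllPairs.map⁺ (AllPairs.map (λ {s} {t} → extendˡ-injective {s} {t}) (splits-distinct n)))
  (All.map⁺ (All.universal (λ s → All.map⁺ (All.universal (separated s) (splits n))) (splits n)))
  where
  N = 2 ^ n
  extendʳ-injective : ∀ {s t : Split N} → LeftsDiffer s t → LeftsDiffer (extendʳ s) (extendʳ t)
  extendʳ-injective {s} {t} s≢t eq =
    s≢t (trans (sym (leftValue-extendʳ s)) (trans eq (leftValue-extendʳ t)))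
  extendˡ-injective : ∀ {s t : Split N} → LeftsDiffer s t → LeftsDiffer (extendˡ s) (extendˡ t)
  extendˡ-injective {s} {t} s≢t eq = s≢t (*-cancelˡ-≡ _ _ (1 + 10 ^ N)
    (trans (sym (leftValue-extendˡ s)) (trans eq (leftValue-extendˡ t))))
  separated : ∀ (s t : Split N) → LeftsDiffer (extendʳ s) (extendˡ t)
  separated s t eq = <⇒≱ (leftValue-< s)
    (≤-trans (leftValue-extendˡ-large t) (≤-reflexive (trans (sym eq) (leftValue-extendʳ s))))

binomial-sum : ∀ n → sumUpTo n (n C_) ≡ 2 ^ n
binomial-sum zero    = refl
binomial-sum (suc n) = begin
  sumUpTo (suc n) (suc n C_)
    ≡⟨ sumUpTo-peel n (suc n C_) ⟩
  1 + sumUpTo n (λ j → suc n C suc j)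
    ≡⟨ cong (1 +_) (sumUpTo-cong n (λ j _ → sym (nCk+nC[k+1]≡[n+1]C[k+1] n j))) ⟩
  1 + sumUpTo n (λ j → n C j + n C suc j)
    ≡⟨ cong (1 +_) (sumUpTo-+ n _ _) ⟩
  1 + (S + T)
    ≡⟨ shuffle S T ⟩
  S + (1 + T)
    ≡⟨ cong (S +_) (sym (sumUpTo-peel n (n C_))) ⟩
  S + (S + n C suc n)
    ≡⟨ cong (λ c → S + (S + c)) (k>n⇒nCk≡0 (n<1+n n)) ⟩
  S + (S + 0)
    ≡⟨ cong (λ z → z + (z + 0)) (binomial-sum n) ⟩
  2 ^ suc n
    ∎
  where
  open ≡-Reasoning
  S = sumUpTo n (n C_)
  T = sumUpTo n (λ j → n C suc j)
  shuffle : ∀ a b → 1 + (a + b) ≡ a + (1 + b)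
  shuffle = solve-∀

binomial-tail-symmetry : ∀ {n} l k → l + k ≡ n → sumUpTo k (n C_) ≡ sumUpTo k (λ j → n C (l + j))
binomial-tail-symmetry l k refl = trans (sumUpTo-reverse k _) (sumUpTo-cong k λ j j≤k → begin
  (l + k) C (k ∸ j)                 ≡⟨ cong ((l + k) C_) (sym ([m+n]∸[m+o]≡n∸o l k j)) ⟩
  (l + k) C ((l + k) ∸ (l + j))     ≡⟨ sym (nCk≡nC[n∸k] (+-monoʳ-≤ l j≤k)) ⟩
  (l + k) C (l + j)                 ∎)
  where open ≡-Reasoning

odd-halves : ∀ {n} k → k + suc k ≡ n → 2 * sumUpTo k (n C_) ≡ 2 ^ n
odd-halves k refl = begin
  2 * S                                               ≡⟨ twice S ⟩
  S + S                                               ≡⟨ cong (S +_) (binomial-tail-symmetry (suc k) k (sym (+-suc k k))) ⟩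
  S + sumUpTo k (λ j → (k + suc k) C (suc k + j))     ≡⟨ sym (sumUpTo-split k k _) ⟩
  sumUpTo (k + suc k) ((k + suc k) C_)                ≡⟨ binomial-sum (k + suc k) ⟩
  2 ^ (k + suc k)                                     ∎
  where
  open ≡-Reasoning
  S = sumUpTo k ((k + suc k) C_)

even-halves : ∀ {n} t → suc t + suc t ≡ n → 2 * sumUpTo t (n C_) + n C suc t ≡ 2 ^ n
even-halves t refl = begin
  2 * S + c                                                  ≡⟨ regroup S c ⟩
  (S + c) + S                                                ≡⟨ cong ((S + c) +_) (binomial-tail-symmetry (suc (suc t)) t (sym (+-suc (suc t) t))) ⟩
  sumUpTo (suc t) (n C_) + sumUpTo t (λ j → n C (suc (suc t) + j))  ≡⟨ sym (sumUpTo-split (suc t) t _) ⟩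
  sumUpTo n (n C_)                                           ≡⟨ binomial-sum n ⟩
  2 ^ n                                                      ∎
  where
  open ≡-Reasoning
  n = suc t + suc t
  S = sumUpTo t (n C_)
  c = n C suc t
  regroup : ∀ a b → 2 * a + b ≡ (a + b) + a
  regroup = solve-∀

data Parity : ℕ → Set where
  even : ∀ q → Parity (q * 2)
  odd  : ∀ q → Parity (1 + q * 2)

parity : ∀ n → Parity n
parity zero = even 0
parity (suc n) with parity n
... | even q = odd q
... | odd q  = even (suc q)

%2-odd : ∀ q → (1 + q * 2) % 2 ≡ 1
%2-odd q = [m+kn]%n≡m%n 1 q 2

/2-odd : ∀ q → (1 + q * 2) / 2 ≡ q
/2-odd q = trans (+-distrib-/-∣ʳ 1 (n∣m*n q {2})) (m*n/n≡m q 2)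

%2-even : ∀ q → (q * 2) % 2 ≡ 0
%2-even q = m*n%n≡0 q 2

/2-even : ∀ q → (q * 2) / 2 ≡ q
/2-even q = m*n/n≡m q 2

M-odd : ∀ q → M (1 + q * 2) ≡ sum1To q ((1 + q * 2) C_)
M-odd q rewrite %2-odd q | /2-odd q = refl

M-even : ∀ q → M (q * 2) ≡ sum1To (q ∸ 1) ((q * 2) C_) + ((q * 2) C q) / 2
M-even q rewrite %2-even q | /2-even q = refl

*2≡+ : ∀ q → q * 2 ≡ q + q
*2≡+ q = trans (*-comm q 2) (twice q)

-- In both parities 2 M(n) = 2^n - 2 (the unordered nontrivial ways to split n
-- factors in two); only the strict bound is needed.
twice-M< : ∀ n → 1 ≤ n → 2 * M n < 2 ^ n
twice-M< n 1≤n with parity n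
twice-M< _ () | even zero
twice-M< _ _  | odd q rewrite M-odd q = begin-strict
  2 * X                           <⟨ *-monoʳ-< 2 (n<1+n X) ⟩
  2 * (1 + X)                     ≡⟨ cong (2 *_) (sym (sumUpTo≡head+sum1To q (n C_))) ⟩
  2 * sumUpTo q (n C_)            ≡⟨ odd-halves q (trans (+-suc q q) (cong suc (sym (*2≡+ q)))) ⟩
  2 ^ n                           ∎
  where
  open ≤-Reasoning
  n = 1 + q * 2
  X = sum1To q (n C_)
twice-M< _ _  | even (suc t) rewrite M-even (suc t) = begin-strict
  2 * (X + c / 2)                 ≡⟨ *-distribˡ-+ 2 X (c / 2) ⟩
  2 * X + 2 * (c / 2)             ≤⟨ +-monoʳ-≤ (2 * X) (≤-trans (≤-reflexive (*-comm 2 (c / 2))) (m/n*n≤m c 2)) ⟩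
  2 * X + c                       <⟨ +-monoˡ-< c (*-monoʳ-< 2 (n<1+n X)) ⟩
  2 * (1 + X) + c                 ≡⟨ cong (λ z → 2 * z + c) (sym (sumUpTo≡head+sum1To t (n C_))) ⟩
  2 * sumUpTo t (n C_) + c        ≡⟨ even-halves t (sym (*2≡+ (suc t))) ⟩
  2 ^ n                           ∎
  where
  open ≤-Reasoning
  n = suc t * 2
  X = sum1To t (n C_)
  c = n C suc t

M≤2^[n-1] : ∀ m → M (suc m) ≤ 2 ^ m
M≤2^[n-1] m = <⇒≤ (*-cancelˡ-< 2 (M (suc m)) (2 ^ m) (twice-M< (suc m) (s≤s z≤n)))

repunitFactors : ℕ → List ℕ
repunitFactors zero    = []
repunitFactors (suc n) = (1 + 10 ^ (2 ^ n)) ∷ repunitFactors n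

repunitFactors-length : ∀ n → length (repunitFactors n) ≡ n
repunitFactors-length zero    = refl
repunitFactors-length (suc n) = cong suc (repunitFactors-length n)

repunitFactors-product : ∀ n → product (repunitFactors n) ≡ R (2 ^ n)
repunitFactors-product zero    = refl
repunitFactors-product (suc n) =
  trans (cong ((1 + 10 ^ (2 ^ n)) *_) (repunitFactors-product n)) (sym (R-double (2 ^ n)))

repunitFactors-< : ∀ n → All (_< 1 + 10 ^ (2 ^ n)) (repunitFactors n)
repunitFactors-< zero    = []
repunitFactors-< (suc n) = head< ∷ All.map (λ x< → <-trans x< head<) (repunitFactors-< n)
  where
  head< : 1 + 10 ^ (2 ^ n) < 1 + 10 ^ (2 ^ suc n)
  head< = s≤s (^-monoʳ-< 10 (s≤s (s≤s z≤n)) (^-monoʳ-< 2 (s≤s (s≤s z≤n)) (n<1+n n)))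

repunitFactors-unique : ∀ n → Unique (repunitFactors n)
repunitFactors-unique zero    = []
repunitFactors-unique (suc n) =
  All.map (λ x< eq → <-irrefl (sym eq) x<) (repunitFactors-< n) ∷ repunitFactors-unique n

repunitFactors-pos : ∀ n → All (0 <_) (repunitFactors n)
repunitFactors-pos zero    = []
repunitFactors-pos (suc n) = s≤s z≤n ∷ repunitFactors-pos n

-- A right-extended split gives an ordered polynomial pair with product R(2N):
-- its left value is below 10^N and its right value is at least 10^N.
extendʳ-pair : ∀ {N} (s : Split N) → let p = toPair (extendʳ s) in
  (proj₁ p ≤ proj₂ p) × (proj₁ p * proj₂ p ≡ R (2 * N)) × PolyPair (proj₁ p) (proj₂ p)
extendʳ-pair {N} s =
  <⇒≤ (<-≤-trans left-small right-large) , value (extendʳ s) , split-polyPair (extendʳ s)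
  where
  left-small : leftValue (extendʳ s) < 10 ^ N
  left-small = ≤-trans (s≤s (≤-reflexive (leftValue-extendʳ s))) (leftValue-< s)
  right-large : 10 ^ N ≤ fromDigits (right s ++ right s)
  right-large rewrite sym (right-length s) = fromDigits-double-large (right s) (right-unit s)

theorem8 : (n : ℕ) → 1 ≤ n →
    (Σ (List ℕ) λ xs →
       (length xs ≡ n) × Unique xs × All (λ x → 0 < x) xs × (product xs ≡ R (2 ^ n)))
    × (Σ (List (ℕ × ℕ)) λ ps →
       Unique ps
       × All (λ p → (proj₁ p ≤ proj₂ p) × (proj₁ p * proj₂ p ≡ R (2 ^ n)) × PolyPair (proj₁ p) (proj₂ p)) ps
       × (M n ≤ length ps))
theorem8 (suc m) _ =
  ( repunitFactors (suc m) , repunitFactors-length (suc m) , repunitFactors-unique (suc m)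
  , repunitFactors-pos (suc m) , repunitFactors-product (suc m) )
  , ( map pairOf (splits m)
    , AllPairs.map⁺ (AllPairs.map (λ {s} {t} → pairs-differ {s} {t}) (splits-distinct m))
    , All.map⁺ (All.universal extendʳ-pair (splits m))
    , ≤-trans (M≤2^[n-1] m) (≤-reflexive (sym (trans (length-map pairOf (splits m)) (splits-length m)))) )
  where
  pairOf : Split (2 ^ m) → ℕ × ℕ
  pairOf s = toPair (extendʳ s)
  pairs-differ : ∀ {s t} → LeftsDiffer s t → pairOf s ≢ pairOf t
  pairs-differ {s} {t} s≢t eq = s≢t (trans (sym (leftValue-extendʳ s)) (trans (cong proj₁ eq) (leftValue-extendʳ t)))
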